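{- Let $q$ be an even power of $2$ (i.e., $q=2^v$ with $v$ a positive even integer) and let $s=1+(q+1)(\sqrt{q}-1)$. Then in the desarguesian projective plane $\mathrm{PG}(2,q)$ there exist a set $Y$ of $s$ points and a set $\mathcal{M}$ of $s$ lines such that no point of $Y$ lies on any line of $\mathcal{M}$.
   Context: $\mathrm{PG}(2,q)$ denotes the desarguesian projective plane over the finite field $\mathbb{F}_q$: its points are the 1-dimensional subspaces and its lines the 2-dimensional subspaces of $\mathbb{F}_q^3$, with incidence given by containment. -}

module Defs where

open import Level using (Level; _⊔_)
open import Algebra.Bundles using (CommutativeRing)
open import Data.Nat using (ℕ)
open import Data.Fin using (Fin)
open import Data.Product using (_×_; ∃; ∃₂)
open import Relation.Nullary using (¬_)
open import Relation.Binary.PropositionalEquality using (_≡_)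

record IsFieldOfOrder {c ℓ : Level} (F : CommutativeRing c ℓ) (q : ℕ) : Set (c ⊔ ℓ) where
  open CommutativeRing F
  field
    0≉1       : ¬ (0# ≈ 1#)
    inverse   : ∀ x → ¬ (x ≈ 0#) → ∃ λ y → x * y ≈ 1#
    enum      : Fin q → Carrier
    enum-surj : ∀ x → ∃ λ i → enum i ≈ x
    enum-inj  : ∀ i j → enum i ≈ enum j → i ≡ j

-- Projective plane PG(2,F) via the vector space F^3.
module Plane {c ℓ : Level} (F : CommutativeRing c ℓ) where
  open CommutativeRing F

  V3 : Set c
  V3 = Fin 3 → Carrier

  IsZero : V3 → Set ℓ
  IsZero v = ∀ i → v i ≈ 0#

  InSpan : V3 → V3 → V3 → Set (c ⊔ ℓ)
  InSpan v u w = ∃₂ λ a b → ∀ i → v i ≈ a * u i + b * w i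

  -- a point (1-dim subspace) is represented by a nonzero spanning vector
  record Point : Set (c ⊔ ℓ) where
    constructor point
    field
      vec     : V3
      nonzero : ¬ IsZero vec

  SamePoint : Point → Point → Set (c ⊔ ℓ)
  SamePoint P Q = ∃ λ a → ∀ i → Point.vec P i ≈ a * Point.vec Q i

  -- a line (2-dim subspace) is represented by two linearly independent spanning vectors
  record Line : Set (c ⊔ ℓ) where
    constructor line
    field
      u₁ u₂ : V3
      indep : ∀ a b → (∀ i → a * u₁ i + b * u₂ i ≈ 0#) → (a ≈ 0#) × (b ≈ 0#)

  SameLine : Line → Line → Set (c ⊔ ℓ)
  SameLine L M = InSpan (Line.u₁ L) (Line.u₁ M) (Line.u₂ M)
               × InSpan (Line.u₂ L) (Line.u₁ M) (Line.u₂ M)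
               × InSpan (Line.u₁ M) (Line.u₁ L) (Line.u₂ L)
               × InSpan (Line.u₂ M) (Line.u₁ L) (Line.u₂ L)

  _I_ : Point → Line → Set (c ⊔ ℓ)
  P I L = InSpan (Point.vec P) (Line.u₁ L) (Line.u₂ L)

-- Let ℘(u) = u² + u. In characteristic two ℘ is additive with kernel {0, 1}, so its image H has
-- index two; for δ ∉ H the form Q(x, y) = x² + xy + δy² is anisotropic, and its polar form
-- polar(n, p) = n₁p₂ + n₂p₁ satisfies: polar(n, p) = 1 implies Q(n)Q(p) ∉ H. For q = 2^{2k} choose
-- k-dimensional F₂-subspaces A, B with AB ⊆ H: A is arbitrary, and B is cut out of the field by
-- the k linear conditions b·aᵢ ∈ H for a basis (aᵢ) of A. Take the points (x, y, 1) with
-- Q(x, y) ∈ A ∖ 0 together with (0, 0, 1), and the lines Z = αX + βY with Q(β, α) ∈ B ∖ 0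
-- together with Z = 0; each nonzero value of Q is taken once in each of the q + 1 directions,
-- so there are s of each. A point (x, y, 1) on Z = αX + βY would have polar((β, α), (x, y)) = 1,
-- so Q(β, α)Q(x, y) ∉ H, although it lies in BA ⊆ H.
module Submission where

open import Defs
open import Level using (Level; _⊔_)
open import Algebra.Bundles using (CommutativeRing)
open import Data.Nat as ℕ using (ℕ; zero; suc; _^_; _∸_)
import Data.Nat.Properties as ℕ
open import Data.Fin as Fin using (Fin; zero; suc)
import Data.Fin.Properties as Fin
open import Data.Vec using (Vec; []; _∷_; lookup; replicate; zipWith)
open import Data.Vec.Functional as Vector using (Vector)
open import Data.Bool using (Bool; true; false; _xor_; not; if_then_else_)
open import Data.Product using (_×_; _,_; proj₁; proj₂; Σ; ∃; ∃₂; swap; uncurry)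
open import Data.Sum using (_⊎_; inj₁; inj₂; [_,_]′)
open import Data.Empty using (⊥-elim)
open import Function using (_∘_)
open import Function.Definitions using (Injective)
open import Relation.Binary.PropositionalEquality as ≡ using (_≡_; cong; cong₂; subst; subst₂)
open import Relation.Nullary using (¬_; Dec; yes; no; does)

module Bits where

  open import Data.Nat.Properties using (m+[n∸m]≡n; m^n>0; 1+n≢0)
  open import Data.Fin using (combine; remQuot; toℕ; cast)
  open import Data.Fin.Properties
    using (remQuot-combine; combine-remQuot; toℕ-↑ˡ; toℕ-cast; toℕ-injective; suc-injective)
  open import Data.Bool.Properties using (xor-comm; xor-same)
  open import Data.Vec.Properties using (∷-injectiveˡ; ∷-injectiveʳ)
  open import Relation.Binary.PropositionalEquality

  Bits : ℕ → Set
  Bits = Vec Bool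

  zeros : ∀ {n} → Bits n
  zeros = replicate _ false

  infixl 6 _⊕_
  _⊕_ : ∀ {n} → Bits n → Bits n → Bits n
  _⊕_ = zipWith _xor_

  ⊕-identityˡ : ∀ {n} (v : Bits n) → zeros ⊕ v ≡ v
  ⊕-identityˡ []      = refl
  ⊕-identityˡ (b ∷ v) = cong (b ∷_) (⊕-identityˡ v)

  ⊕-self : ∀ {n} (v : Bits n) → v ⊕ v ≡ zeros
  ⊕-self []      = refl
  ⊕-self (b ∷ v) = cong₂ _∷_ (xor-same b) (⊕-self v)

  bit : Bool → Fin 2
  bit false = zero
  bit true  = suc zero

  unbit : Fin 2 → Bool
  unbit zero       = false
  unbit (suc zero) = true

  encode : ∀ {n} → Bits n → Fin (2 ^ n)
  encode []      = zero
  encode (b ∷ v) = combine (bit b) (encode v)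

  decode : ∀ {n} → Fin (2 ^ n) → Bits n
  decode {zero}  _ = []
  decode {suc n} i = unbit (proj₁ (remQuot (2 ^ n) i)) ∷ decode (proj₂ (remQuot {2} (2 ^ n) i))

  decode-encode : ∀ {n} (v : Bits n) → decode (encode v) ≡ v
  decode-encode []      = refl
  decode-encode {suc n} (b ∷ v) = cong₂ _∷_
    (trans (cong (λ r → unbit (proj₁ r)) split) (unbit-bit b))
    (trans (cong (λ r → decode {n} (proj₂ r)) split) (decode-encode v))
    where
    split = remQuot-combine {2} {2 ^ n} (bit b) (encode v)
    unbit-bit : ∀ b → unbit (bit b) ≡ b
    unbit-bit false = refl
    unbit-bit true  = refl

  encode-decode : ∀ {n} (i : Fin (2 ^ n)) → encode {n} (decode i) ≡ i
  encode-decode {zero}  zero = refl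
  encode-decode {suc n} i = trans
    (cong₂ combine (bit-unbit (proj₁ (remQuot (2 ^ n) i))) (encode-decode {n} _))
    (combine-remQuot {2} (2 ^ n) i)
    where
    bit-unbit : ∀ i → bit (unbit i) ≡ i
    bit-unbit zero       = refl
    bit-unbit (suc zero) = refl

  decode-injective : ∀ {n} {i j : Fin (2 ^ n)} → decode {n} i ≡ decode j → i ≡ j
  decode-injective {n} {i} {j} p =
    trans (sym (encode-decode {n} i)) (trans (cong encode p) (encode-decode {n} j))

  toℕ-encode-zeros : ∀ {n} → toℕ (encode {n} zeros) ≡ 0
  toℕ-encode-zeros {zero}  = refl
  toℕ-encode-zeros {suc n} = trans (toℕ-↑ˡ (encode {n} zeros) _) (toℕ-encode-zeros {n})

  nonzero : ∀ {n} → Fin (2 ^ n ∸ 1) → Bits n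
  nonzero {n} j = decode (cast (m+[n∸m]≡n (m^n>0 2 n)) (suc j))

  nonzero-injective : ∀ {n} {i j} → nonzero {n} i ≡ nonzero j → i ≡ j
  nonzero-injective {n} {i} {j} p = suc-injective (toℕ-injective
    (trans (sym (toℕ-cast _ (suc i))) (trans (cong toℕ (decode-injective {n} p)) (toℕ-cast _ (suc j)))))

  nonzero≢zeros : ∀ {n} j → ¬ nonzero {n} j ≡ zeros
  nonzero≢zeros {n} j p = 1+n≢0 (begin
    suc (toℕ j)                                          ≡⟨ sym (toℕ-cast _ (suc j)) ⟩
    toℕ (cast _ (suc j))                                 ≡⟨ cong toℕ (sym (encode-decode {n} _)) ⟩
    toℕ (encode (nonzero {n} j))                         ≡⟨ cong (λ v → toℕ (encode v)) p ⟩
    toℕ (encode {n} zeros)                               ≡⟨ toℕ-encode-zeros {n} ⟩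
    0                                                    ∎)
    where open ≡-Reasoning

  IsAdditive : ∀ {n} → (Bits n → Bool) → Set
  IsAdditive φ = ∀ v w → φ (v ⊕ w) ≡ φ v xor φ w

  additive-zeros : ∀ {n} (φ : Bits n → Bool) → IsAdditive φ → φ zeros ≡ false
  additive-zeros φ φ-add = begin
    φ zeros                ≡⟨ cong φ (sym (⊕-self zeros)) ⟩
    φ (zeros ⊕ zeros)      ≡⟨ φ-add zeros zeros ⟩
    φ zeros xor φ zeros    ≡⟨ xor-same (φ zeros) ⟩
    false                  ∎
    where open ≡-Reasoning

  additive-split : ∀ {n} (φ : Bits (suc n) → Bool) → IsAdditive φ → ∀ t v →
    φ (t ∷ v) ≡ φ (t ∷ zeros) xor φ (false ∷ v)
  additive-split φ φ-add t v =
    trans (cong φ (cong₂ _∷_ (xor-comm false t) (sym (⊕-identityˡ v)))) (φ-add (t ∷ zeros) (false ∷ v))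

  -- An additive injective parametrisation of the kernel of φ: if φ does not vanish on the first
  -- unit vector, the first coordinate is solved for; otherwise φ is restricted to the others.
  kernel : ∀ {n} → (Bits (suc n) → Bool) → Bits n → Bits (suc n)
  kernel {zero}  φ []      = false ∷ []
  kernel {suc n} φ (t ∷ v) =
    if φ (true ∷ zeros) then φ (false ∷ t ∷ v) ∷ t ∷ v
    else t ∷ kernel (λ w → φ (false ∷ w)) v

  kernel-annihilated : ∀ {n} (φ : Bits (suc n) → Bool) → IsAdditive φ →
    ∀ v → φ (kernel φ v) ≡ false
  kernel-annihilated {zero} φ φ-add [] = additive-zeros φ φ-add
  kernel-annihilated {suc n} φ φ-add (t ∷ v) with φ (true ∷ zeros) in e₁
  ... | true with φ (false ∷ t ∷ v) in e₂
  ...   | true  = trans (additive-split φ φ-add true (t ∷ v)) (cong₂ _xor_ e₁ e₂)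
  ...   | false =
    trans (additive-split φ φ-add false (t ∷ v)) (cong₂ _xor_ (additive-zeros φ φ-add) e₂)
  kernel-annihilated {suc n} φ φ-add (t ∷ v) | false =
    trans (additive-split φ φ-add t (kernel φ′ v))
      (cong₂ _xor_ (first t) (kernel-annihilated φ′ (λ x y → φ-add (false ∷ x) (false ∷ y)) v))
    where
    φ′ : Bits (suc n) → Bool
    φ′ w = φ (false ∷ w)
    first : ∀ t → φ (t ∷ zeros) ≡ false
    first false = additive-zeros φ φ-add
    first true  = e₁

  kernel-additive : ∀ {n} (φ : Bits (suc n) → Bool) → IsAdditive φ →
    ∀ v w → kernel φ (v ⊕ w) ≡ kernel φ v ⊕ kernel φ w
  kernel-additive {zero}  φ φ-add [] [] = refl
  kernel-additive {suc n} φ φ-add (t ∷ v) (u ∷ w) with φ (true ∷ zeros)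
  ... | true  = cong (_∷ (t xor u) ∷ (v ⊕ w)) (φ-add (false ∷ t ∷ v) (false ∷ u ∷ w))
  ... | false = cong ((t xor u) ∷_)
    (kernel-additive (λ x → φ (false ∷ x)) (λ x y → φ-add (false ∷ x) (false ∷ y)) v w)

  kernel-injective : ∀ {n} (φ : Bits (suc n) → Bool) →
    ∀ v w → kernel φ v ≡ kernel φ w → v ≡ w
  kernel-injective {zero}  φ [] [] _ = refl
  kernel-injective {suc n} φ (t ∷ v) (u ∷ w) p with φ (true ∷ zeros)
  ... | true  = ∷-injectiveʳ p
  ... | false =
    cong₂ _∷_ (∷-injectiveˡ p) (kernel-injective (λ x → φ (false ∷ x)) v w (∷-injectiveʳ p))

open Bits

module FiniteField {c ℓ} (F : CommutativeRing c ℓ) {q : ℕ} (isField : IsFieldOfOrder F q) where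

  open CommutativeRing F hiding (zero)
  open IsFieldOfOrder isField
  open import Relation.Binary.Reasoning.Setoid setoid
  open import Algebra.Properties.Ring ring using (-‿involutive; -0#≈0#)

  index : Carrier → Fin q
  index x = proj₁ (enum-surj x)

  enum-index : ∀ x → enum (index x) ≈ x
  enum-index x = proj₂ (enum-surj x)

  index-cong : ∀ {x y} → x ≈ y → index x ≡ index y
  index-cong {x} {y} x≈y = enum-inj _ _ (trans (enum-index x) (trans x≈y (sym (enum-index y))))

  index-injective : ∀ {x y} → index x ≡ index y → x ≈ y
  index-injective {x} {y} p = trans (sym (enum-index x)) (trans (reflexive (cong enum p)) (enum-index y))

  infix 4 _≟_
  _≟_ : ∀ x y → Dec (x ≈ y)
  x ≟ y with index x Fin.≟ index y
  ... | yes p = yes (index-injective p)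
  ... | no ¬p = no (¬p ∘ index-cong)

  module _ {m : ℕ} {e : Vector Carrier m} (e-inj : Injective _≡_ _≈_ e) where

    injective⇒≤ : m ℕ.≤ q
    injective⇒≤ = Fin.injective⇒≤ (e-inj ∘ index-injective)

    ∷-injective : ∀ {x} → (∀ i → ¬ e i ≈ x) → Injective _≡_ _≈_ (x Vector.∷ e)
    ∷-injective {_} _   {zero}  {zero}  _ = ≡.refl
    ∷-injective x∉e {zero}  {suc j} p = ⊥-elim (x∉e j (sym p))
    ∷-injective x∉e {suc i} {zero}  p = ⊥-elim (x∉e i p)
    ∷-injective _   {suc i} {suc j} p = cong suc (e-inj p)

    ∃-∉-image : m ℕ.< q → ∃ λ x → ∀ i → ¬ e i ≈ x
    ∃-∉-image m<q with Fin.all? (λ j → Fin.any? (λ i → e i ≟ enum j))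
    ... | yes hit = ⊥-elim (ℕ.<⇒≱ m<q (Fin.injective⇒≤ preimage-injective))
      where
      preimage-injective : Injective _≡_ _≡_ (λ j → proj₁ (hit j))
      preimage-injective {j} {j′} p = enum-inj j j′
        (trans (sym (proj₂ (hit j))) (trans (reflexive (cong e p)) (proj₂ (hit j′))))
    ... | no ¬hit with Fin.¬∀⟶∃¬ q _ (λ j → Fin.any? (λ i → e i ≟ enum j)) ¬hit
    ...   | j , j∉e = enum j , λ i p → j∉e (i , p)

  injective⇒surjective : (f : Carrier → Carrier) → (∀ {x y} → f x ≈ f y → x ≈ y) →
                         ∀ y → ∃ λ x → f x ≈ y
  injective⇒surjective f f-inj y with Fin.any? (λ i → f (enum i) ≟ y)
  ... | yes (i , p) = enum i , p
  ... | no y∉f =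
    ⊥-elim (ℕ.<-irrefl ≡.refl (injective⇒≤ (∷-injective fe-inj λ i p → y∉f (i , p))))
    where
    fe-inj : Injective _≡_ _≈_ (f ∘ enum)
    fe-inj p = enum-inj _ _ (f-inj p)

  module _ (f : Carrier → Carrier) (f-cong : ∀ {x y} → x ≈ y → f x ≈ f y)
           (f-surj : ∀ y → ∃ λ x → f x ≈ y) where

    private
      -- a section of f that respects ≈, obtained by choosing preimages along enum
      g : Carrier → Carrier
      g z = proj₁ (f-surj (enum (index z)))

      fg : ∀ z → f (g z) ≈ z
      fg z = trans (proj₂ (f-surj (enum (index z)))) (enum-index z)

      g-cong : ∀ {z z′} → z ≈ z′ → g z ≈ g z′
      g-cong p = reflexive (cong (λ i → proj₁ (f-surj (enum i))) (index-cong p))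

      g-inj : ∀ {z z′} → g z ≈ g z′ → z ≈ z′
      g-inj {z} {z′} p = trans (sym (fg z)) (trans (f-cong p) (fg z′))

    surjective⇒injective : ∀ {x y} → f x ≈ f y → x ≈ y
    surjective⇒injective {x} {y} fx≈fy
      with injective⇒surjective g g-inj x | injective⇒surjective g g-inj y
    ... | x′ , gx′≈x | y′ , gy′≈y = begin
      x    ≈⟨ sym gx′≈x ⟩
      g x′ ≈⟨ g-cong x′≈y′ ⟩
      g y′ ≈⟨ gy′≈y ⟩
      y    ∎
      where
      x′≈y′ : x′ ≈ y′
      x′≈y′ = begin
        x′        ≈⟨ sym (fg x′) ⟩
        f (g x′)  ≈⟨ f-cong gx′≈x ⟩
        f x       ≈⟨ fx≈fy ⟩
        f y       ≈⟨ f-cong (sym gy′≈y) ⟩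
        f (g y′)  ≈⟨ fg y′ ⟩
        y′        ∎

  zero-product : ∀ x y → x * y ≈ 0# → x ≈ 0# ⊎ y ≈ 0#
  zero-product x y xy≈0 with x ≟ 0#
  ... | yes x≈0 = inj₁ x≈0
  ... | no x≉0 with inverse x x≉0
  ...   | x⁻¹ , xx⁻¹≈1 = inj₂ (begin
    y              ≈⟨ sym (*-identityˡ y) ⟩
    1# * y         ≈⟨ *-congʳ (sym (trans (*-comm x⁻¹ x) xx⁻¹≈1)) ⟩
    (x⁻¹ * x) * y  ≈⟨ *-assoc x⁻¹ x y ⟩
    x⁻¹ * (x * y)  ≈⟨ *-congˡ xy≈0 ⟩
    x⁻¹ * 0#       ≈⟨ zeroʳ x⁻¹ ⟩
    0#             ∎)

  -- a total inverse, with the junk value 0⁻¹ = 0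
  _⁻¹ : Carrier → Carrier
  x ⁻¹ with x ≟ 0#
  ... | yes _   = 0#
  ... | no x≉0 = proj₁ (inverse x x≉0)

  *-inverseʳ : ∀ x → ¬ x ≈ 0# → x * x ⁻¹ ≈ 1#
  *-inverseʳ x x≉0 with x ≟ 0#
  ... | yes x≈0  = ⊥-elim (x≉0 x≈0)
  ... | no x≉0′ = proj₂ (inverse x x≉0′)

  module OddCharacteristic (2≉0 : ¬ 1# + 1# ≈ 0#) where

    x≉-x : ∀ x → ¬ x ≈ 0# → ¬ x ≈ - x
    x≉-x x x≉0 x≈-x with zero-product (1# + 1#) x 2x≈0
      where
      2x≈0 : (1# + 1#) * x ≈ 0#
      2x≈0 = begin
        (1# + 1#) * x  ≈⟨ distribʳ x 1# 1# ⟩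
        1# * x + 1# * x ≈⟨ +-cong (*-identityˡ x) (*-identityˡ x) ⟩
        x + x          ≈⟨ +-congʳ x≈-x ⟩
        - x + x        ≈⟨ -‿inverseˡ x ⟩
        0#             ∎
    ... | inj₁ 2≈0 = 2≉0 2≈0
    ... | inj₂ x≈0 = x≉0 x≈0

    SymmetricFamily : ℕ → Set (c ⊔ ℓ)
    SymmetricFamily n = Σ (Vector Carrier n) λ e →
      Injective _≡_ _≈_ e × (∀ i → ∃ λ j → e j ≈ - e i) × (∃ λ i → e i ≈ 0#)

    extend : ∀ {n} → n ℕ.< q → SymmetricFamily n → SymmetricFamily (suc (suc n))
    extend n<q (e , e-inj , e-neg , i₀ , e₀≈0) with ∃-∉-image e-inj n<q
    ... | x , x∉e =
      (x Vector.∷ - x Vector.∷ e) , ∷-injective (∷-injective e-inj -x∉e) x∉-x∷e , neg , suc (suc i₀) , e₀≈0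
      where
      x≉0 : ¬ x ≈ 0#
      x≉0 x≈0 = x∉e i₀ (trans e₀≈0 (sym x≈0))
      -x∉e : ∀ i → ¬ e i ≈ - x
      -x∉e i ei≈-x with e-neg i
      ... | j , ej≈-ei = x∉e j (trans ej≈-ei (trans (-‿cong ei≈-x) (-‿involutive x)))
      x∉-x∷e : ∀ i → ¬ (- x Vector.∷ e) i ≈ x
      x∉-x∷e zero    -x≈x = x≉-x x x≉0 (sym -x≈x)
      x∉-x∷e (suc i) ei≈x = x∉e i ei≈x
      neg : ∀ i → ∃ λ j → (x Vector.∷ - x Vector.∷ e) j ≈ - (x Vector.∷ - x Vector.∷ e) i
      neg zero          = suc zero , refl
      neg (suc zero)    = zero , sym (-‿involutive x)
      neg (suc (suc i)) with e-neg i
      ... | j , ej≈-ei = suc (suc j) , ej≈-ei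

    symmetricFamily : ∀ m → m ℕ.+ m ℕ.≤ q → SymmetricFamily (suc (m ℕ.+ m))
    symmetricFamily zero    _ =
      (λ _ → 0#) , (λ { {zero} {zero} _ → ≡.refl }) , (λ _ → zero , sym -0#≈0#) , zero , refl
    symmetricFamily (suc m) 2m+2≤q =
      subst SymmetricFamily (cong (λ n → suc (suc n)) (≡.sym (ℕ.+-suc m m)))
      (extend 2m+1<q (symmetricFamily m (ℕ.<⇒≤ (ℕ.<-trans (ℕ.n<1+n _) 2m+1<q))))
      where
      2m+1<q : suc (m ℕ.+ m) ℕ.< q
      2m+1<q = subst (ℕ._≤ q) (cong suc (ℕ.+-suc m m)) 2m+2≤q

  -- Pairing each nonzero x with -x shows that a field with 1 + 1 ≉ 0 has odd order.
  even-order⇒characteristic-two : ∀ h → q ≡ h ℕ.+ h → 1# + 1# ≈ 0#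
  even-order⇒characteristic-two h q≡h+h with 1# + 1# ≟ 0#
  ... | yes 2≈0 = 2≈0
  ... | no 2≉0 =
    ⊥-elim (ℕ.<-irrefl ≡.refl (subst (λ n → suc n ℕ.≤ q) (≡.sym q≡h+h) (injective⇒≤ family-inj)))
    where
    family = OddCharacteristic.symmetricFamily 2≉0 h (ℕ.≤-reflexive (≡.sym q≡h+h))
    family-inj : Injective _≡_ _≈_ (proj₁ family)
    family-inj = proj₁ (proj₂ family)

  C² : Set c
  C² = Carrier × Carrier

  infix 4 _≈²_
  _≈²_ : C² → C² → Set ℓ
  (x₁ , x₂) ≈² (y₁ , y₂) = x₁ ≈ y₁ × x₂ ≈ y₂

  infixr 7 _·_
  _·_ : Carrier → C² → C²
  t · (x₁ , x₂) = t * x₁ , t * x₂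

  𝟎 : C²
  𝟎 = 0# , 0#

  ≈²-sym : ∀ {u v} → u ≈² v → v ≈² u
  ≈²-sym (x≈y , x′≈y′) = sym x≈y , sym x′≈y′

  infixl 6 _+²_
  _+²_ : C² → C² → C²
  (x₁ , x₂) +² (y₁ , y₂) = x₁ + y₁ , x₂ + y₂

  -- the affine point (x, y) lies on the line Z = αX + βY exactly when ⟨ (x , y) , (α , β) ⟩ ≈ 1
  ⟨_,_⟩ : C² → C² → Carrier
  ⟨ (x , y) , (α , β) ⟩ = x * α + y * β

  ⟨𝟎,_⟩≈0 : ∀ l → ⟨ 𝟎 , l ⟩ ≈ 0#
  ⟨𝟎, (α , β) ⟩≈0 = trans (+-cong (zeroˡ α) (zeroˡ β)) (+-identityʳ 0#)

  ⟨_,𝟎⟩≈0 : ∀ u → ⟨ u , 𝟎 ⟩ ≈ 0#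
  ⟨ (x , y) ,𝟎⟩≈0 = trans (+-cong (zeroʳ x) (zeroʳ y)) (+-identityʳ 0#)

  ⟨⟩-cong : ∀ {u u′ l l′} → u ≈² u′ → l ≈² l′ → ⟨ u , l ⟩ ≈ ⟨ u′ , l′ ⟩
  ⟨⟩-cong (x≈x′ , y≈y′) (α≈α′ , β≈β′) = +-cong (*-cong x≈x′ α≈α′) (*-cong y≈y′ β≈β′)

  𝟎∷-injective : ∀ {m} {g : Fin m → C²} → Injective _≡_ _≈²_ g → (∀ i → ¬ g i ≈² 𝟎) →
                 Injective _≡_ _≈²_ (𝟎 Vector.∷ g)
  𝟎∷-injective g-inj g≉𝟎 {zero}  {zero}  _ = ≡.refl
  𝟎∷-injective g-inj g≉𝟎 {zero}  {suc j} p = ⊥-elim (g≉𝟎 j (≈²-sym p))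
  𝟎∷-injective g-inj g≉𝟎 {suc i} {zero}  p = ⊥-elim (g≉𝟎 i p)
  𝟎∷-injective g-inj g≉𝟎 {suc i} {suc j} p = cong suc (g-inj p)

  swap-injective : ∀ {m} {g : Fin m → C²} → Injective _≡_ _≈²_ g → Injective _≡_ _≈²_ (swap ∘ g)
  swap-injective g-inj = g-inj ∘ swap

  module CharacteristicTwo (2≈0 : 1# + 1# ≈ 0#) where

    open import Algebra.Solver.Ring.NaturalCoefficients.Default commutativeSemiring

    x+x≈0 : ∀ x → x + x ≈ 0#
    x+x≈0 x = begin
      x + x            ≈⟨ sym (+-cong (*-identityˡ x) (*-identityˡ x)) ⟩
      1# * x + 1# * x  ≈⟨ sym (distribʳ x 1# 1#) ⟩
      (1# + 1#) * x    ≈⟨ *-congʳ 2≈0 ⟩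
      0# * x           ≈⟨ zeroˡ x ⟩
      0#               ∎

    drop-double : ∀ {x y} z → x ≈ y + (z + z) → x ≈ y
    drop-double {y = y} z x≈y+2z = trans x≈y+2z (trans (+-congˡ (x+x≈0 z)) (+-identityʳ y))

    x+y+y≈x : ∀ x y → x + y + y ≈ x
    x+y+y≈x x y = drop-double y (solve 2 (λ x y → (x :+ y) :+ y := x :+ (y :+ y)) refl x y)

    x+y≈0⇒x≈y : ∀ {x y} → x + y ≈ 0# → x ≈ y
    x+y≈0⇒x≈y {x} {y} x+y≈0 = trans (sym (x+y+y≈x x y)) (trans (+-congʳ x+y≈0) (+-identityˡ y))

    x+y≈z⇒x≈z+y : ∀ {x y z} → x + y ≈ z → x ≈ z + y
    x+y≈z⇒x≈z+y {x} {y} x+y≈z = trans (sym (x+y+y≈x x y)) (+-congʳ x+y≈z)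

    +-cancelˡ : ∀ {x y z} → x + y ≈ x + z → y ≈ z
    +-cancelˡ {x} {y} {z} p = begin
      y          ≈⟨ sym (x+y+y≈x y x) ⟩
      y + x + x  ≈⟨ +-congʳ (trans (+-comm y x) (trans p (+-comm x z))) ⟩
      z + x + x  ≈⟨ x+y+y≈x z x ⟩
      z          ∎

    square-+ : ∀ x y → (x + y) * (x + y) ≈ x * x + y * y
    square-+ x y = drop-double (x * y)
      (solve 2 (λ x y → (x :+ y) :* (x :+ y) := (x :* x :+ y :* y) :+ (x :* y :+ x :* y)) refl x y)

    square≈0⇒≈0 : ∀ {x} → x * x ≈ 0# → x ≈ 0#
    square≈0⇒≈0 {x} xx≈0 with zero-product x x xx≈0
    ... | inj₁ x≈0 = x≈0
    ... | inj₂ x≈0 = x≈0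

    square-injective : ∀ {x y} → x * x ≈ y * y → x ≈ y
    square-injective {x} {y} xx≈yy =
      x+y≈0⇒x≈y (square≈0⇒≈0 (trans (square-+ x y) (trans (+-congʳ xx≈yy) (x+x≈0 (y * y)))))

    √_ : Carrier → Carrier
    √ y = proj₁ (injective⇒surjective (λ x → x * x) square-injective y)

    √-square : ∀ y → √ y * √ y ≈ y
    √-square y = proj₂ (injective⇒surjective (λ x → x * x) square-injective y)

    select : Bool → Carrier → Carrier
    select true  x = x
    select false x = 0#

    lincomb : ∀ {n} → Vec Carrier n → Bits n → Carrier
    lincomb []       []      = 0#
    lincomb (x ∷ xs) (t ∷ v) = select t x + lincomb xs v

    lincomb-⊕ : ∀ {n} (xs : Vec Carrier n) v w → lincomb xs (v ⊕ w) ≈ lincomb xs v + lincomb xs w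
    lincomb-⊕ []       []      []      = sym (+-identityˡ 0#)
    lincomb-⊕ (x ∷ xs) (t ∷ v) (u ∷ w) =
      trans (+-cong (select-xor t u) (lincomb-⊕ xs v w))
            (solve 4 (λ a b c d → (a :+ b) :+ (c :+ d) := (a :+ c) :+ (b :+ d)) refl _ _ _ _)
      where
      select-xor : ∀ t u → select (t xor u) x ≈ select t x + select u x
      select-xor false false = sym (+-identityˡ 0#)
      select-xor false true  = sym (+-identityˡ x)
      select-xor true  false = sym (+-identityʳ x)
      select-xor true  true  = sym (x+x≈0 x)

    Independent : ∀ {n} → Vec Carrier n → Set ℓ
    Independent xs = Injective _≡_ _≈_ (lincomb xs)

    independent-∷ : ∀ {n} {xs : Vec Carrier n} {x} → Independent xs →
                    (∀ v → ¬ lincomb xs v ≈ x) → Independent (x ∷ xs)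
    independent-∷ {xs = xs} {x} xs-ind x∉span = injective
      where
      x≈span : ∀ {v w} → x + lincomb xs v ≈ 0# + lincomb xs w → lincomb xs (w ⊕ v) ≈ x
      x≈span {v} {w} p = trans (lincomb-⊕ xs w v) (sym (trans (x+y≈z⇒x≈z+y p) (+-congʳ (+-identityˡ _))))
      injective : Independent (x ∷ xs)
      injective {false ∷ v} {false ∷ w} p = cong (false ∷_) (xs-ind (+-cancelˡ p))
      injective {true ∷ v}  {true ∷ w}  p = cong (true ∷_) (xs-ind (+-cancelˡ p))
      injective {true ∷ v}  {false ∷ w} p = ⊥-elim (x∉span (w ⊕ v) (x≈span p))
      injective {false ∷ v} {true ∷ w}  p = ⊥-elim (x∉span (v ⊕ w) (x≈span (sym p)))

    independent-extend : ∀ {n} {xs : Vec Carrier n} → Independent xs → 2 ℕ.^ n ℕ.< q →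
                         ∃ λ x → Independent (x ∷ xs)
    independent-extend {xs = xs} xs-ind 2ⁿ<q
      with ∃-∉-image {e = lincomb xs ∘ decode} (decode-injective ∘ xs-ind) 2ⁿ<q
    ... | x , x∉span = x , independent-∷ xs-ind λ v p →
      x∉span (encode v) (trans (reflexive (cong (lincomb xs) (decode-encode v))) p)

    ∃-independent : ∀ n → 2 ℕ.^ n ℕ.≤ q → Σ (Vec Carrier n) Independent
    ∃-independent zero    _       = [] , λ { {[]} {[]} _ → ≡.refl }
    ∃-independent (suc n) 2ⁿ⁺¹≤q = proj₁ extension ∷ proj₁ basis , proj₂ extension
      where
      2ⁿ<q : 2 ℕ.^ n ℕ.< q
      2ⁿ<q = ℕ.<-≤-trans (ℕ.^-monoʳ-< 2 (ℕ.s≤s (ℕ.s≤s ℕ.z≤n)) (ℕ.n<1+n n)) 2ⁿ⁺¹≤q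
      basis = ∃-independent n (ℕ.<⇒≤ 2ⁿ<q)
      extension = independent-extend (proj₂ basis) 2ⁿ<q

    ℘ : Carrier → Carrier
    ℘ u = u * u + u

    ℘-cong : ∀ {u v} → u ≈ v → ℘ u ≈ ℘ v
    ℘-cong u≈v = +-cong (*-cong u≈v u≈v) u≈v

    ℘-+ : ∀ u v → ℘ (u + v) ≈ ℘ u + ℘ v
    ℘-+ u v = begin
      (u + v) * (u + v) + (u + v)  ≈⟨ +-congʳ (square-+ u v) ⟩
      (u * u + v * v) + (u + v)    ≈⟨ solve 4 (λ a b u v → (a :+ b) :+ (u :+ v) := (a :+ u) :+ (b :+ v)) refl _ _ u v ⟩
      ℘ u + ℘ v                    ∎

    ℘-fibre : ∀ {u v} → ℘ u ≈ ℘ v → u ≈ v ⊎ v ≈ u + 1#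
    ℘-fibre {u} {v} ℘u≈℘v with zero-product (u + v) (u + v + 1#) ℘[u+v]≈0
      where
      ℘[u+v]≈0 : (u + v) * (u + v + 1#) ≈ 0#
      ℘[u+v]≈0 = begin
        (u + v) * (u + v + 1#)          ≈⟨ distribˡ (u + v) (u + v) 1# ⟩
        (u + v) * (u + v) + (u + v) * 1# ≈⟨ +-congˡ (*-identityʳ (u + v)) ⟩
        ℘ (u + v)                       ≈⟨ ℘-+ u v ⟩
        ℘ u + ℘ v                       ≈⟨ +-congʳ ℘u≈℘v ⟩
        ℘ v + ℘ v                       ≈⟨ x+x≈0 (℘ v) ⟩
        0#                              ∎
    ... | inj₁ u+v≈0   = inj₁ (x+y≈0⇒x≈y u+v≈0)
    ... | inj₂ u+v+1≈0 =
      inj₂ (trans (x+y≈z⇒x≈z+y (trans (+-comm v u) (x+y≈0⇒x≈y u+v+1≈0))) (+-comm 1# u))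

    Im℘ : Carrier → Set (c ⊔ ℓ)
    Im℘ y = ∃ λ u → ℘ u ≈ y

    Im℘-cong : ∀ {x y} → x ≈ y → Im℘ x → Im℘ y
    Im℘-cong x≈y (u , ℘u≈x) = u , trans ℘u≈x x≈y

    ℘0≈0 : ℘ 0# ≈ 0#
    ℘0≈0 = trans (+-identityʳ _) (zeroˡ 0#)

    Im℘-0 : Im℘ 0#
    Im℘-0 = 0# , ℘0≈0

    Im℘-+ : ∀ {x y} → Im℘ x → Im℘ y → Im℘ (x + y)
    Im℘-+ (u , ℘u≈x) (v , ℘v≈y) = u + v , trans (℘-+ u v) (+-cong ℘u≈x ℘v≈y)

    Im℘? : ∀ y → Dec (Im℘ y)
    Im℘? y with Fin.any? (λ j → ℘ (enum j) ≟ y)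
    ... | yes (j , p) = yes (enum j , p)
    ... | no ∄j       = no λ (u , ℘u≈y) → ∄j (index u , trans (℘-cong (enum-index u)) ℘u≈y)

    -- ℘ identifies 0 and 1, so it is not injective, hence not surjective.
    ∃-∉Im℘ : ∃ λ δ → ¬ Im℘ δ
    ∃-∉Im℘ with Fin.all? (λ j → Im℘? (enum j))
    ... | yes all = ⊥-elim (0≉1 (surjective⇒injective ℘ ℘-cong onto (trans ℘0≈0 (sym ℘1≈0))))
      where
      onto : ∀ y → Im℘ y
      onto y = Im℘-cong (enum-index y) (all (index y))
      ℘1≈0 : ℘ 1# ≈ 0#
      ℘1≈0 = trans (+-congʳ (*-identityˡ 1#)) (x+x≈0 1#)
    ... | no ¬all with Fin.¬∀⟶∃¬ q _ (λ j → Im℘? (enum j)) ¬all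
    ...   | j , j∉Im℘ = enum j , j∉Im℘

    -- Of the two elements u, u + 1 of each fibre of ℘, the one of smaller index represents it.
    Representative : Carrier → Set
    Representative u = index u Fin.≤ index (u + 1#)

    representative-cong : ∀ {u v} → u ≈ v → Representative u → Representative v
    representative-cong u≈v = subst₂ Fin._≤_ (index-cong u≈v) (index-cong (+-congʳ u≈v))

    index-u+1+1 : ∀ u → index (u + 1# + 1#) ≡ index u
    index-u+1+1 u = index-cong (x+y+y≈x u 1#)

    representative-+1 : ∀ {u} → ¬ Representative u → Representative (u + 1#)
    representative-+1 {u} ¬rep =
      subst (index (u + 1#) Fin.≤_) (≡.sym (index-u+1+1 u)) (ℕ.<⇒≤ (ℕ.≰⇒> ¬rep))

    representative-unique : ∀ {u} → Representative u → ¬ Representative (u + 1#)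
    representative-unique {u} rep rep′ = 0≉1 (+-cancelˡ (trans (+-identityʳ u) (index-injective
      (Fin.≤-antisym rep (subst (index (u + 1#) Fin.≤_) (index-u+1+1 u) rep′)))))

    module _ {x : Carrier} (x∉Im℘ : ¬ Im℘ x) where

      private
        shift : Carrier → Carrier
        shift u with Fin._≤?_ (index u) (index (u + 1#))
        ... | yes _ = ℘ u
        ... | no  _ = x + ℘ u

        x+℘v≉℘u : ∀ u v → ¬ x + ℘ v ≈ ℘ u
        x+℘v≉℘u u v p = x∉Im℘ (u + v , sym (trans (x+y≈z⇒x≈z+y p) (sym (℘-+ u v))))

        shift-injective : ∀ {u v} → shift u ≈ shift v → u ≈ v
        shift-injective {u} {v} p with Fin._≤?_ (index u) (index (u + 1#)) | Fin._≤?_ (index v) (index (v + 1#))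
        ... | yes rep | yes rep′ with ℘-fibre p
        ...   | inj₁ u≈v   = u≈v
        ...   | inj₂ v≈u+1 = ⊥-elim (representative-unique rep (representative-cong v≈u+1 rep′))
        shift-injective p | no ¬rep | no ¬rep′ with ℘-fibre (+-cancelˡ p)
        ...   | inj₁ u≈v   = u≈v
        ...   | inj₂ v≈u+1 = ⊥-elim (¬rep′ (representative-cong (sym v≈u+1) (representative-+1 ¬rep)))
        shift-injective {u} {v} p | yes _ | no _ = ⊥-elim (x+℘v≉℘u u v (sym p))
        shift-injective {u} {v} p | no _ | yes _ = ⊥-elim (x+℘v≉℘u v u p)

      -- shift is injective, hence surjective, so every y ∉ Im℘ is a value x + ℘ u.
      Im℘-index-two : ∀ {y} → ¬ Im℘ y → Im℘ (x + y)
      Im℘-index-two {y} y∉Im℘ with injective⇒surjective shift shift-injective y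
      ... | u , p with Fin._≤?_ (index u) (index (u + 1#))
      ...   | yes _ = ⊥-elim (y∉Im℘ (u , p))
      ...   | no  _ = u , sym (trans (+-congˡ (sym p)) (trans (sym (+-assoc x x (℘ u)))
                                (trans (+-congʳ (x+x≈0 x)) (+-identityˡ (℘ u)))))

    outside℘ : Carrier → Bool
    outside℘ y = not (does (Im℘? y))

    outside℘-cong : ∀ {x y} → x ≈ y → outside℘ x ≡ outside℘ y
    outside℘-cong {x} {y} x≈y with Im℘? x | Im℘? y
    ... | yes _  | yes _  = ≡.refl
    ... | no _   | no _   = ≡.refl
    ... | yes hx | no ¬hy = ⊥-elim (¬hy (Im℘-cong x≈y hx))
    ... | no ¬hx | yes hy = ⊥-elim (¬hx (Im℘-cong (sym x≈y) hy))

    outside℘-+ : ∀ x y → outside℘ (x + y) ≡ outside℘ x xor outside℘ y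
    outside℘-+ x y with Im℘? x | Im℘? y | Im℘? (x + y)
    ... | yes _  | yes _  | yes _    = ≡.refl
    ... | yes hx | yes hy | no ¬hxy  = ⊥-elim (¬hxy (Im℘-+ hx hy))
    ... | yes _  | no _   | no _     = ≡.refl
    ... | yes hx | no ¬hy | yes hxy  =
      ⊥-elim (¬hy (Im℘-cong (trans (+-congʳ (+-comm x y)) (x+y+y≈x y x)) (Im℘-+ hxy hx)))
    ... | no _   | yes _  | no _     = ≡.refl
    ... | no ¬hx | yes hy | yes hxy  = ⊥-elim (¬hx (Im℘-cong (x+y+y≈x x y) (Im℘-+ hxy hy)))
    ... | no _   | no _   | yes _    = ≡.refl
    ... | no ¬hx | no ¬hy | no ¬hxy  = ⊥-elim (¬hxy (Im℘-index-two ¬hx ¬hy))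

    outside℘≡false⇒Im℘ : ∀ y → outside℘ y ≡ false → Im℘ y
    outside℘≡false⇒Im℘ y p with Im℘? y
    ... | yes hy = hy

    record Subspace (m : ℕ) : Set (c ⊔ ℓ) where
      field
        embed        : Bits m → Carrier
        embed-⊕      : ∀ v w → embed (v ⊕ w) ≈ embed v + embed w
        embed-inject : Injective _≡_ _≈_ embed

    open Subspace

    span : ∀ {n} (xs : Vec Carrier n) → Independent xs → Subspace n
    span xs xs-ind = record { embed = lincomb xs ; embed-⊕ = lincomb-⊕ xs ; embed-inject = xs-ind }

    embed-zeros : ∀ {m} (S : Subspace m) → embed S zeros ≈ 0#
    embed-zeros S = sym (+-cancelˡ (trans (+-identityʳ _)
      (trans (reflexive (cong (embed S) (≡.sym (⊕-self zeros)))) (embed-⊕ S zeros zeros))))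

    _⊆_ : ∀ {m n} → Subspace m → Subspace n → Set ℓ
    S ⊆ T = ∀ v → ∃ λ w → embed S v ≈ embed T w

    ⊆-trans : ∀ {l m n} {S : Subspace l} {T : Subspace m} {U : Subspace n} → S ⊆ T → T ⊆ U → S ⊆ U
    ⊆-trans S⊆T T⊆U v with S⊆T v
    ... | w , Sv≈Tw with T⊆U w
    ...   | u , Tw≈Uu = u , trans Sv≈Tw Tw≈Uu

    annihilator : ∀ {m} (S : Subspace (suc m)) (a : Carrier) →
                  Σ (Subspace m) λ S′ → (∀ v → Im℘ (embed S′ v * a)) × S′ ⊆ S
    annihilator {m} S a =
      S′ , (λ v → outside℘≡false⇒Im℘ _ (kernel-annihilated φ φ-add v)) , (λ v → kernel φ v , refl)
      where
      φ : Bits (suc m) → Bool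
      φ w = outside℘ (embed S w * a)
      φ-add : IsAdditive φ
      φ-add v w =
        ≡.trans (outside℘-cong (trans (*-congʳ (embed-⊕ S v w)) (distribʳ a _ _))) (outside℘-+ _ _)
      S′ : Subspace m
      S′ = record
        { embed        = embed S ∘ kernel φ
        ; embed-⊕      = λ v w →
            trans (reflexive (cong (embed S) (kernel-additive φ φ-add v w))) (embed-⊕ S _ _)
        ; embed-inject = kernel-injective φ _ _ ∘ embed-inject S
        }

    annihilatorOf : ∀ {j m} (as : Vec Carrier j) (S : Subspace (j ℕ.+ m)) →
                    Σ (Subspace m) λ S′ → (∀ v i → Im℘ (embed S′ v * lookup as i)) × S′ ⊆ S
    annihilatorOf []       S = S , (λ _ ()) , (λ v → v , refl)
    annihilatorOf (a ∷ as) S with annihilator S a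
    ... | S₁ , S₁a⊆Im℘ , S₁⊆S with annihilatorOf as S₁
    ...   | S₂ , S₂as⊆Im℘ , S₂⊆S₁ =
      S₂ , S₂[a∷as]⊆Im℘ , ⊆-trans {S = S₂} {T = S₁} {U = S} S₂⊆S₁ S₁⊆S
      where
      S₂[a∷as]⊆Im℘ : ∀ v i → Im℘ (embed S₂ v * lookup (a ∷ as) i)
      S₂[a∷as]⊆Im℘ v zero with S₂⊆S₁ v
      ... | w , S₂v≈S₁w = Im℘-cong (*-congʳ (sym S₂v≈S₁w)) (S₁a⊆Im℘ w)
      S₂[a∷as]⊆Im℘ v (suc i) = S₂as⊆Im℘ v i

    Im℘-lincomb : ∀ {j} (as : Vec Carrier j) μ → (∀ i → Im℘ (μ * lookup as i)) →
                  ∀ w → Im℘ (μ * lincomb as w)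
    Im℘-lincomb []       μ _   []      = Im℘-cong (sym (zeroʳ μ)) Im℘-0
    Im℘-lincomb (a ∷ as) μ μas⊆Im℘ (t ∷ w) =
      Im℘-cong (sym (distribˡ μ _ _)) (Im℘-+ (μ·select t) (Im℘-lincomb as μ (μas⊆Im℘ ∘ suc) w))
      where
      μ·select : ∀ t → Im℘ (μ * select t a)
      μ·select true  = μas⊆Im℘ zero
      μ·select false = Im℘-cong (sym (zeroʳ μ)) Im℘-0

    *-cancelˡ : ∀ {t x y} → ¬ t ≈ 0# → t * x ≈ t * y → x ≈ y
    *-cancelˡ {t} {x} {y} t≉0 tx≈ty
      with zero-product t (x + y) (trans (distribˡ t x y) (trans (+-congʳ tx≈ty) (x+x≈0 _)))
    ... | inj₁ t≈0   = ⊥-elim (t≉0 t≈0)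
    ... | inj₂ x+y≈0 = x+y≈0⇒x≈y x+y≈0

    module QuadraticForm {δ : Carrier} (δ∉Im℘ : ¬ Im℘ δ) where

      Q : C² → Carrier
      Q (x , y) = x * x + x * y + δ * (y * y)

      Q-cong : ∀ {u v} → u ≈² v → Q u ≈ Q v
      Q-cong (x≈x′ , y≈y′) =
        +-cong (+-cong (*-cong x≈x′ x≈x′) (*-cong x≈x′ y≈y′)) (*-congˡ (*-cong y≈y′ y≈y′))

      Q-· : ∀ t u → Q (t · u) ≈ (t * t) * Q u
      Q-· t (x , y) = solve 4
        (λ t x y d → (t :* x) :* (t :* x) :+ (t :* x) :* (t :* y) :+ d :* ((t :* y) :* (t :* y))
                  := (t :* t) :* (x :* x :+ x :* y :+ d :* (y :* y)))
        refl t x y δ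

      Q-𝟎 : Q 𝟎 ≈ 0#
      Q-𝟎 = trans (+-cong (+-cong (zeroˡ 0#) (zeroˡ 0#)) (trans (*-congˡ (zeroˡ 0#)) (zeroʳ δ)))
                  (trans (+-identityʳ _) (+-identityʳ 0#))

      Q-,0 : ∀ x → Q (x , 0#) ≈ x * x
      Q-,0 x = trans (+-cong (trans (+-congˡ (zeroʳ x)) (+-identityʳ _))
                             (trans (*-congˡ (zeroˡ 0#)) (zeroʳ δ)))
                     (+-identityʳ _)

      Q-,1 : ∀ t → Q (t , 1#) ≈ ℘ t + δ
      Q-,1 t = +-cong (+-congˡ (*-identityʳ t)) (trans (*-congˡ (*-identityˡ 1#)) (*-identityʳ δ))

      Q-anisotropic : ∀ u → Q u ≈ 0# → u ≈² 𝟎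
      Q-anisotropic (x , y) Qu≈0 with y ≟ 0#
      ... | yes y≈0 = square≈0⇒≈0 (trans (sym (Q-,0 x)) (trans (Q-cong (refl , sym y≈0)) Qu≈0)) , y≈0
      ... | no y≉0  = ⊥-elim (δ∉Im℘ (x * y ⁻¹ , x+y≈0⇒x≈y (begin
        ℘ (x * y ⁻¹) + δ             ≈⟨ sym (Q-,1 (x * y ⁻¹)) ⟩
        Q (x * y ⁻¹ , 1#)            ≈⟨ Q-cong (*-comm x (y ⁻¹) , sym (trans (*-comm _ y) (*-inverseʳ y y≉0))) ⟩
        Q (y ⁻¹ · (x , y))           ≈⟨ Q-· (y ⁻¹) (x , y) ⟩
        (y ⁻¹ * y ⁻¹) * Q (x , y)    ≈⟨ *-congˡ Qu≈0 ⟩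
        (y ⁻¹ * y ⁻¹) * 0#           ≈⟨ zeroʳ _ ⟩
        0#                           ∎)))

      polar : C² → C² → Carrier
      polar n p = ⟨ p , swap n ⟩

      Q-+² : ∀ u v → Q (u +² v) ≈ Q u + Q v + polar u v
      Q-+² (x₁ , x₂) (y₁ , y₂) = drop-double (x₁ * y₁ + δ * x₂ * y₂) (solve 5
        (λ x₁ x₂ y₁ y₂ d →
             (x₁ :+ y₁) :* (x₁ :+ y₁) :+ (x₁ :+ y₁) :* (x₂ :+ y₂) :+ d :* ((x₂ :+ y₂) :* (x₂ :+ y₂))
          := (x₁ :* x₁ :+ x₁ :* x₂ :+ d :* (x₂ :* x₂)) :+ (y₁ :* y₁ :+ y₁ :* y₂ :+ d :* (y₂ :* y₂))
             :+ (y₁ :* x₂ :+ y₂ :* x₁) :+ (x₁ :* y₁ :+ d :* x₂ :* y₂ :+ (x₁ :* y₁ :+ d :* x₂ :* y₂)))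
        refl x₁ x₂ y₁ y₂ δ)

      polar-·ˡ : ∀ t n p → polar (t · n) p ≈ t * polar n p
      polar-·ˡ t (n₁ , n₂) (p₁ , p₂) = solve 5
        (λ t n₁ n₂ p₁ p₂ → p₁ :* (t :* n₂) :+ p₂ :* (t :* n₁) := t :* (p₁ :* n₂ :+ p₂ :* n₁))
        refl t n₁ n₂ p₁ p₂

      polar-·-self : ∀ t n → polar n (t · n) ≈ 0#
      polar-·-self t (n₁ , n₂) =
        trans (+-congʳ (solve 3 (λ t n₁ n₂ → (t :* n₁) :* n₂ := (t :* n₂) :* n₁) refl t n₁ n₂)) (x+x≈0 _)

      polar-+ʳ : ∀ n u v → polar n (u +² v) ≈ polar n u + polar n v
      polar-+ʳ (n₁ , n₂) (x₁ , x₂) (y₁ , y₂) = solve 6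
        (λ n₁ n₂ x₁ x₂ y₁ y₂ → (x₁ :+ y₁) :* n₂ :+ (x₂ :+ y₂) :* n₁
                            := (x₁ :* n₂ :+ x₂ :* n₁) :+ (y₁ :* n₂ :+ y₂ :* n₁))
        refl n₁ n₂ x₁ x₂ y₁ y₂

      Q-shift : ∀ {n p u w} → Q n * w ≈ u → polar n p ≈ 1# → Q n * Q (w · n +² p) ≈ ℘ u + Q n * Q p
      Q-shift {n} {p} {u} {w} Qn*w≈u np≈1 = begin
        Q n * Q (w · n +² p)
          ≈⟨ *-congˡ (Q-+² (w · n) p) ⟩
        Q n * (Q (w · n) + Q p + polar (w · n) p)
          ≈⟨ *-congˡ (+-cong (+-congʳ (Q-· w n)) (polar-·ˡ w n p)) ⟩
        Q n * ((w * w) * Q n + Q p + w * polar n p)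
          ≈⟨ solve 4 (λ m w b r → m :* ((w :* w) :* m :+ r :+ w :* b)
                               := (m :* w) :* (m :* w) :+ (m :* w) :* b :+ m :* r) refl (Q n) w (polar n p) (Q p) ⟩
        (Q n * w) * (Q n * w) + (Q n * w) * polar n p + Q n * Q p
          ≈⟨ +-congʳ (+-cong (*-cong Qn*w≈u Qn*w≈u) (trans (*-cong Qn*w≈u np≈1) (*-identityʳ u))) ⟩
        ℘ u + Q n * Q p
          ∎

      polar-shift : ∀ w n p → polar n (w · n +² p) ≈ polar n p
      polar-shift w n p = begin
        polar n (w · n +² p)         ≈⟨ polar-+ʳ n (w · n) p ⟩
        polar n (w · n) + polar n p  ≈⟨ +-congʳ (polar-·-self w n) ⟩
        0# + polar n p               ≈⟨ +-identityˡ _ ⟩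
        polar n p                    ∎

      -- If Q n Q p = ℘ u, then with w = u / Q n the vector v = w n + p has Q n Q v = ℘ u + Q n Q p = 0,
      -- so v = 0, contradicting polar n v = polar n p = 1.
      polar≈1⇒∉Im℘ : ∀ n p → polar n p ≈ 1# → ¬ Im℘ (Q n * Q p)
      polar≈1⇒∉Im℘ n p np≈1 (u , ℘u≈QnQp) =
        [ Qn≉0 , Qv≉0 ]′ (zero-product (Q n) (Q (w · n +² p)) QnQv≈0)
        where
        Qn≉0 : ¬ Q n ≈ 0#
        Qn≉0 Qn≈0 = 0≉1 (trans (sym ⟨ p ,𝟎⟩≈0) (trans (⟨⟩-cong (refl , refl) (≈²-sym (swap n≈𝟎))) np≈1))
          where n≈𝟎 = Q-anisotropic n Qn≈0
        w : Carrier
        w = u * Q n ⁻¹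
        Qn*w≈u : Q n * w ≈ u
        Qn*w≈u = trans (solve 3 (λ m u i → m :* (u :* i) := u :* (m :* i)) refl (Q n) u (Q n ⁻¹))
                       (trans (*-congˡ (*-inverseʳ (Q n) Qn≉0)) (*-identityʳ u))
        QnQv≈0 : Q n * Q (w · n +² p) ≈ 0#
        QnQv≈0 = trans (Q-shift Qn*w≈u np≈1) (trans (+-congʳ ℘u≈QnQp) (x+x≈0 _))
        Qv≉0 : ¬ Q (w · n +² p) ≈ 0#
        Qv≉0 Qv≈0 = 0≉1 (begin
          0#                    ≈⟨ sym ⟨𝟎, swap n ⟩≈0 ⟩
          polar n 𝟎             ≈⟨ ⟨⟩-cong (≈²-sym (Q-anisotropic _ Qv≈0)) (refl , refl) ⟩
          polar n (w · n +² p)  ≈⟨ polar-shift w n p ⟩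
          polar n p             ≈⟨ np≈1 ⟩
          1#                    ∎)

      -- the q + 1 points of the projective line: slopes (1, t) and the vertical direction (0, 1)
      direction : Fin q ⊎ Fin 1 → C²
      direction (inj₁ j) = 1# , enum j
      direction (inj₂ _) = 0# , 1#

      Q-direction≉0 : ∀ s → ¬ Q (direction s) ≈ 0#
      Q-direction≉0 (inj₁ j) Q≈0 = 0≉1 (sym (proj₁ (Q-anisotropic _ Q≈0)))
      Q-direction≉0 (inj₂ _) Q≈0 = 0≉1 (sym (proj₂ (Q-anisotropic _ Q≈0)))

      conicPoint : Fin q ⊎ Fin 1 → Carrier → C²
      conicPoint s a = √ (a * Q (direction s) ⁻¹) · direction s

      Q-conicPoint : ∀ s a → Q (conicPoint s a) ≈ a
      Q-conicPoint s a = begin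
        Q (conicPoint s a)                          ≈⟨ Q-· (√ (a * Q (direction s) ⁻¹)) (direction s) ⟩
        √ (a * Q (direction s) ⁻¹) * √ (a * Q (direction s) ⁻¹) * Q (direction s)
                                                    ≈⟨ *-congʳ (√-square _) ⟩
        a * Q (direction s) ⁻¹ * Q (direction s)    ≈⟨ *-assoc _ _ _ ⟩
        a * (Q (direction s) ⁻¹ * Q (direction s))  ≈⟨ *-congˡ (trans (*-comm _ _) (*-inverseʳ _ (Q-direction≉0 s))) ⟩
        a * 1#                                      ≈⟨ *-identityʳ a ⟩
        a                                           ∎

      √≉0 : ∀ s {a} → ¬ a ≈ 0# → ¬ √ (a * Q (direction s) ⁻¹) ≈ 0#
      √≉0 s {a} a≉0 √≈0 = a≉0 (begin
        a                        ≈⟨ sym (Q-conicPoint s a) ⟩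
        Q (conicPoint s a)       ≈⟨ Q-cong (trans (*-congʳ √≈0) (zeroˡ _) , trans (*-congʳ √≈0) (zeroˡ _)) ⟩
        Q 𝟎                      ≈⟨ Q-𝟎 ⟩
        0#                       ∎)

      conicPoint-injective : ∀ {s s′ a a′} → ¬ a ≈ 0# → conicPoint s a ≈² conicPoint s′ a′ →
                             s ≡ s′ × a ≈ a′
      conicPoint-injective {s} {s′} {a} {a′} a≉0 p = same-direction s s′ p , a≈a′
        where
        a≈a′ : a ≈ a′
        a≈a′ = trans (sym (Q-conicPoint s a)) (trans (Q-cong p) (Q-conicPoint s′ a′))
        a′≉0 : ¬ a′ ≈ 0#
        a′≉0 = a≉0 ∘ trans a≈a′
        c≈c′ : ∀ {c c′} → c * 1# ≈ c′ * 1# → c ≈ c′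
        c≈c′ p = trans (sym (*-identityʳ _)) (trans p (*-identityʳ _))
        c≈0 : ∀ {c} → c * 1# ≈ 0# → c ≈ 0#
        c≈0 p = trans (sym (*-identityʳ _)) p
        same-direction : ∀ s s′ → conicPoint s a ≈² conicPoint s′ a′ → s ≡ s′
        same-direction (inj₁ j) (inj₁ j′) (c≈c′·1 , cj≈c′j′) = cong inj₁ (enum-inj j j′
          (*-cancelˡ (√≉0 (inj₁ j) a≉0) (trans cj≈c′j′ (*-congʳ (sym (c≈c′ c≈c′·1))))))
        same-direction (inj₁ j) (inj₂ _) (c≈c′0 , _) =
          ⊥-elim (√≉0 (inj₁ j) a≉0 (c≈0 (trans c≈c′0 (zeroʳ _))))
        same-direction (inj₂ _) (inj₁ j′) (c0≈c′ , _) =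
          ⊥-elim (√≉0 (inj₁ j′) a′≉0 (c≈0 (trans (sym c0≈c′) (zeroʳ _))))
        same-direction (inj₂ zero) (inj₂ zero) _ = ≡.refl

      directionOf : ∀ {r} → Fin ((q ℕ.+ 1) ℕ.* r) → Fin q ⊎ Fin 1
      directionOf {r} i = Fin.splitAt q (Fin.quotient r i)

      levelOf : ∀ {r} → Fin ((q ℕ.+ 1) ℕ.* r) → Fin r
      levelOf {r} i = Fin.remainder {q ℕ.+ 1} r i

      conicFamily : ∀ {r} → (Fin r → Carrier) → Fin ((q ℕ.+ 1) ℕ.* r) → C²
      conicFamily f i = conicPoint (directionOf i) (f (levelOf i))

      Q-conicFamily : ∀ {r} (f : Fin r → Carrier) i → Q (conicFamily f i) ≈ f (levelOf i)
      Q-conicFamily f i = Q-conicPoint (directionOf i) (f (levelOf i))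

      conicFamily≉𝟎 : ∀ {r} {f : Fin r → Carrier} → (∀ j → ¬ f j ≈ 0#) → ∀ i → ¬ conicFamily f i ≈² 𝟎
      conicFamily≉𝟎 {f = f} f≉0 i p =
        f≉0 _ (trans (sym (Q-conicFamily f i)) (trans (Q-cong {conicFamily f i} {𝟎} p) Q-𝟎))

      conicFamily-injective : ∀ {r} {f : Fin r → Carrier} → (∀ j → ¬ f j ≈ 0#) → Injective _≡_ _≈_ f →
                              Injective _≡_ _≈²_ (conicFamily f)
      conicFamily-injective {r} {f} f≉0 f-inj {i} {i′} p =
        ≡.trans (≡.sym (Fin.combine-remQuot {q ℕ.+ 1} r i))
          (≡.trans (cong₂ Fin.combine same-quotient (f-inj (proj₂ same))) (Fin.combine-remQuot {q ℕ.+ 1} r i′))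
        where
        same : directionOf i ≡ directionOf i′ × f (levelOf i) ≈ f (levelOf i′)
        same = conicPoint-injective {directionOf i} {directionOf i′} {f (levelOf i)} {f (levelOf i′)} (f≉0 _) p
        same-quotient : Fin.quotient r i ≡ Fin.quotient r i′
        same-quotient = ≡.trans (≡.sym (Fin.join-splitAt q 1 _))
          (≡.trans (cong (Fin.join q 1) (proj₁ same)) (Fin.join-splitAt q 1 _))

  open Plane F

  private
    vec3 : Carrier → Carrier → Carrier → V3
    vec3 x y z zero             = x
    vec3 x y z (suc zero)       = y
    vec3 x y z (suc (suc zero)) = z

    combination-e₁e₂ : ∀ a b → (a * 1# + b * 0# ≈ a) × (a * 0# + b * 1# ≈ b)
    combination-e₁e₂ a b = trans (+-cong (*-identityʳ a) (zeroʳ b)) (+-identityʳ a)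
                         , trans (+-cong (zeroʳ a) (*-identityʳ b)) (+-identityˡ b)

  affinePoint : C² → Point
  affinePoint (x , y) = point (vec3 x y 1#) (λ v≈0 → 0≉1 (sym (v≈0 (suc (suc zero)))))

  affineLine : C² → Line
  affineLine (α , β) = line (vec3 1# 0# α) (vec3 0# 1# β) λ a b ab≈0 →
    trans (sym (proj₁ (combination-e₁e₂ a b))) (ab≈0 zero) ,
    trans (sym (proj₂ (combination-e₁e₂ a b))) (ab≈0 (suc zero))

  InSpan-affineLine : ∀ {x y z} l → InSpan (vec3 x y z) (Line.u₁ (affineLine l)) (Line.u₂ (affineLine l)) →
                      z ≈ ⟨ (x , y) , l ⟩
  InSpan-affineLine (α , β) (a , b , v≈) = trans (v≈ (suc (suc zero)))
    (sym (+-cong (*-congʳ (trans (v≈ zero) (proj₁ (combination-e₁e₂ a b))))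
                 (*-congʳ (trans (v≈ (suc zero)) (proj₂ (combination-e₁e₂ a b))))))

  affinePoint-injective : ∀ {u v} → SamePoint (affinePoint u) (affinePoint v) → u ≈² v
  affinePoint-injective {x , y} {x′ , y′} (a , u≈av) =
    trans (u≈av zero) (trans (*-congʳ a≈1) (*-identityˡ x′)) ,
    trans (u≈av (suc zero)) (trans (*-congʳ a≈1) (*-identityˡ y′))
    where
    a≈1 : a ≈ 1#
    a≈1 = trans (sym (*-identityʳ a)) (sym (u≈av (suc (suc zero))))

  affineLine-injective : ∀ {l l′} → SameLine (affineLine l) (affineLine l′) → l ≈² l′
  affineLine-injective {α , β} {α′ , β′} (u₁∈l′ , u₂∈l′ , _) =
    trans (InSpan-affineLine (α′ , β′) u₁∈l′) (trans (+-cong (*-identityˡ α′) (zeroˡ β′)) (+-identityʳ α′)) ,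
    trans (InSpan-affineLine (α′ , β′) u₂∈l′) (trans (+-cong (zeroˡ α′) (*-identityˡ β′)) (+-identityˡ β′))

  affinePoint-I-affineLine : ∀ {u l} → affinePoint u I affineLine l → ⟨ u , l ⟩ ≈ 1#
  affinePoint-I-affineLine {l = l} u∈l = sym (InSpan-affineLine l u∈l)

  configuration : ∀ {s} (P N : Fin s → C²) → Injective _≡_ _≈²_ P → Injective _≡_ _≈²_ N →
    (∀ i j → ¬ ⟨ P i , N j ⟩ ≈ 1#) →
    ∃₂ λ (Y : Fin s → Point) (M : Fin s → Line) →
      (∀ i j → SamePoint (Y i) (Y j) → i ≡ j)
      × (∀ i j → SameLine (M i) (M j) → i ≡ j)
      × (∀ i j → ¬ (Y i I M j))
  configuration P N P-inj N-inj P∉N = affinePoint ∘ P , affineLine ∘ N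
    , (λ i j → P-inj ∘ affinePoint-injective) , (λ i j → N-inj ∘ affineLine-injective)
    , λ i j → P∉N i j ∘ affinePoint-I-affineLine

module Construction {c ℓ} (F : CommutativeRing c ℓ) (k : ℕ)
                    (isField : IsFieldOfOrder F (2 ^ (2 ℕ.* suc k))) where

  open CommutativeRing F hiding (zero)
  open IsFieldOfOrder isField
  open FiniteField F isField

  q/2 : ℕ
  q/2 = 2 ^ (k ℕ.+ (suc k ℕ.+ 0))

  open CharacteristicTwo (even-order⇒characteristic-two q/2 (cong (q/2 ℕ.+_) (ℕ.+-identityʳ q/2)))
  open Subspace
  open QuadraticForm (proj₂ ∃-∉Im℘)

  -- abstract: unfolding these recursive constructions makes type checking blow up
  abstract
    as : Vec Carrier (suc k)
    as = proj₁ (∃-independent (suc k) (ℕ.^-monoʳ-≤ 2 (ℕ.m≤m+n (suc k) _)))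

    as-independent : Independent as
    as-independent = proj₂ (∃-independent (suc k) (ℕ.^-monoʳ-≤ 2 (ℕ.m≤m+n (suc k) _)))

    wholeField : Subspace (suc k ℕ.+ suc k)
    wholeField = uncurry span (∃-independent (suc k ℕ.+ suc k)
      (ℕ.^-monoʳ-≤ 2 (ℕ.≤-reflexive (cong (suc k ℕ.+_) (≡.sym (ℕ.+-identityʳ (suc k)))))))

    B : Subspace (suc k)
    B = proj₁ (annihilatorOf as wholeField)

    B·as⊆Im℘ : ∀ v i → Im℘ (embed B v * lookup as i)
    B·as⊆Im℘ = proj₁ (proj₂ (annihilatorOf as wholeField))

  A : Subspace (suc k)
  A = span as as-independent

  r : ℕ
  r = 2 ^ suc k ∸ 1

  a b : Fin r → Carrier
  a = lincomb as ∘ nonzero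
  b = embed B ∘ nonzero

  b·a∈Im℘ : ∀ i j → Im℘ (b i * a j)
  b·a∈Im℘ i j = Im℘-lincomb as (b i) (B·as⊆Im℘ (nonzero i)) (nonzero j)

  a≉0 : ∀ j → ¬ a j ≈ 0#
  a≉0 j aj≈0 = nonzero≢zeros j (embed-inject A (trans aj≈0 (sym (embed-zeros A))))

  b≉0 : ∀ j → ¬ b j ≈ 0#
  b≉0 j bj≈0 = nonzero≢zeros j (embed-inject B (trans bj≈0 (sym (embed-zeros B))))

  s : ℕ
  s = 1 ℕ.+ (2 ^ (2 ℕ.* suc k) ℕ.+ 1) ℕ.* (2 ^ suc k ∸ 1)

  P N : Fin s → C²
  P = 𝟎 Vector.∷ conicFamily a
  N = 𝟎 Vector.∷ (swap ∘ conicFamily b)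

  a-injective : Injective _≡_ _≈_ a
  a-injective = nonzero-injective ∘ embed-inject A

  b-injective : Injective _≡_ _≈_ b
  b-injective = nonzero-injective ∘ embed-inject B

  P-injective : Injective _≡_ _≈²_ P
  P-injective =
    𝟎∷-injective {g = conicFamily a} (conicFamily-injective a≉0 a-injective) (conicFamily≉𝟎 a≉0)

  N-injective : Injective _≡_ _≈²_ N
  N-injective = 𝟎∷-injective {g = swap ∘ conicFamily b}
    (swap-injective {g = conicFamily b} (conicFamily-injective b≉0 b-injective))
    (λ i → conicFamily≉𝟎 b≉0 i ∘ swap)

  ⟨P,N⟩≉1 : ∀ i j → ¬ ⟨ P i , N j ⟩ ≈ 1#
  ⟨P,N⟩≉1 zero    j       p = 0≉1 (trans (sym ⟨𝟎, N j ⟩≈0) p)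
  ⟨P,N⟩≉1 (suc i) zero    p = 0≉1 (trans (sym ⟨ P (suc i) ,𝟎⟩≈0) p)
  ⟨P,N⟩≉1 (suc i) (suc j) p = polar≈1⇒∉Im℘ (conicFamily b j) (conicFamily a i) p
    (Im℘-cong (sym (*-cong (Q-conicFamily b j) (Q-conicFamily a i))) (b·a∈Im℘ _ _))

open import Data.Nat using (_+_; _*_; _≤_)

theorem5 : ∀ {c ℓ : Level} (k : ℕ) → 1 ≤ k →
    (F : CommutativeRing c ℓ) → IsFieldOfOrder F (2 ^ (2 * k)) →
    let open Plane F in
    ∃₂ λ (Y : Fin (1 + (2 ^ (2 * k) + 1) * (2 ^ k ∸ 1)) → Point)
         (M : Fin (1 + (2 ^ (2 * k) + 1) * (2 ^ k ∸ 1)) → Line) →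
      (∀ i j → SamePoint (Y i) (Y j) → i ≡ j)
      × (∀ i j → SameLine (M i) (M j) → i ≡ j)
      × (∀ i j → ¬ (Y i I M j))
theorem5 (suc k) _ F isField = FiniteField.configuration F isField P N P-injective N-injective ⟨P,N⟩≉1
  where open Construction F k isField
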